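{- Let $G$ be a $\Delta$-regular multigraph of even order, and let $S \subseteq V(G)$ with $|S|$ odd, $|S|\ge 3$, such that $\langle S\rangle$ is $\Delta$-full or $\Delta$-overfull and has maximum $\Delta$-excess among all induced odd-order subgraphs of $G$ with at least $3$ vertices that are $\Delta$-full or $\Delta$-overfull. Let $S^c = V(G)\setminus S$. Then $\Delta(G_S) \leq \Delta$ and $\Delta(G_{S^c}) \leq \Delta$; moreover $\Gamma(G_S) \leq \Gamma(G)$ and $\Gamma(G_{S^c}) \leq \Gamma(G)$ (each whenever the multigraph in question has at least $3$ vertices, so that its $\Gamma$ is defined).
   Context: Multigraphs are finite and loopless, with parallel edges allowed. $\langle S\rangle$ is the induced subgraph on $S$. For a multigraph $H$ of odd order $\geq 3$, $t(H) = 2e(H)/(n(H)-1)$. For a multigraph $H$ with at least $3$ vertices, $\Gamma(H) = \max\{t(\langle S\rangle): S\subseteq V(H),\ |S| \text{ odd},\ |S|\ge 3\}$; $\Gamma$ is undefined for multigraphs with fewer than 3 vertices. For an integer $k$, an odd-order subgraph $H$ with at least 3 vertices is $k$-overfull if $t(H) > k$ and $k$-full if $t(H)=k$; its $k$-excess is $\mathrm{ex}(H,k) = e(H) - k(n(H)-1)/2$. Shrinking: for a nonempty proper subset $S$ of $V(G)$, $G_S$ has vertex set $(V(G)\setminus S)\cup\{s\}$ with $s$ new; its edges are those of $G$ with both ends outside $S$, plus, for each $u\notin S$, as many $u$–$s$ edges as there are edges of $G$ joining $u$ to $S$. -}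

module Defs where

open import Data.Bool using (Bool; true; false; if_then_else_)
open import Data.Nat using (ℕ; zero; suc; _+_; _*_; _∸_; _≤_; _<_; _≟_)
open import Data.Nat.Divisibility using (_∣_)
open import Data.Integer using (ℤ; +_; _-_)
open import Data.Fin using (Fin; zero; suc; toℕ)
open import Data.Fin.Subset using (Subset; ∣_∣; inside; outside; ∁)
open import Data.Vec using (lookup)
open import Data.List using (List; length; filter)
import Data.List as L
open import Data.List.Base using (allFin)
open import Data.Product using (Σ; _×_; _,_; ∃)
open import Data.Nat using (_<?_)
open import Relation.Nullary using (¬_; Dec; yes; no)
open import Relation.Nullary.Decidable using (⌊_⌋)
open import Relation.Binary.PropositionalEquality using (_≡_)
open import Data.Rational.Unnormalised using (ℚᵘ; mkℚᵘ)
import Data.Rational.Unnormalised as Q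

Mult : ℕ → Set
Mult n = Fin n → Fin n → ℕ

IsMultigraph : ∀ {n} → Mult n → Set
IsMultigraph {n} m = (∀ u v → m u v ≡ m v u) × (∀ u → m u u ≡ 0)

∑ : ∀ n → (Fin n → ℕ) → ℕ
∑ zero    f = 0
∑ (suc n) f = f zero + ∑ n (λ i → f (suc i))

[_∈_]·_ : ∀ {n} → Fin n → Subset n → ℕ → ℕ
[ v ∈ S ]· x = if lookup S v then x else 0

deg : ∀ {n} → Mult n → Fin n → ℕ
deg {n} m v = ∑ n (λ u → m v u)

Regular : ∀ {n} → Mult n → ℕ → Set
Regular {n} m Δ = ∀ v → deg m v ≡ Δ

MaxDegLe : ∀ {n} → Mult n → ℕ → Set
MaxDegLe {n} m Δ = ∀ v → deg m v ≤ Δ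

eInd : ∀ {n} → Mult n → Subset n → ℕ
eInd {n} m S =
  ∑ n (λ u → ∑ n (λ v →
    if ⌊ toℕ u <? toℕ v ⌋ then [ u ∈ S ]· ([ v ∈ S ]· m u v) else 0))

Odd : ℕ → Set
Odd k = ¬ (2 ∣ k)

Even : ℕ → Set
Even k = 2 ∣ k

OddSub : ∀ {n} → Subset n → Set
OddSub S = Odd ∣ S ∣ × 3 ≤ ∣ S ∣

-- t(⟨S⟩) = 2 e(⟨S⟩) / (|S| - 1)   (mkℚᵘ p q denotes p / (suc q);
-- meaningful for |S| ≥ 2, and only used for |S| ≥ 3)
t : ∀ {n} → Mult n → Subset n → ℚᵘ
t m S = mkℚᵘ (+ (2 * eInd m S)) (∣ S ∣ ∸ 2)

ℕ→ℚᵘ : ℕ → ℚᵘ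
ℕ→ℚᵘ k = mkℚᵘ (+ k) 0

-- k-excess ex(⟨S⟩,k) = e(⟨S⟩) - k(|S|-1)/2
ex : ∀ {n} → Mult n → Subset n → ℕ → ℚᵘ
ex m S k = mkℚᵘ (+ (2 * eInd m S) - + (k * (∣ S ∣ ∸ 1))) 1

FullOrOverfull : ∀ {n} → Mult n → Subset n → ℕ → Set
FullOrOverfull m S k = ℕ→ℚᵘ k Q.≤ t m S

IsΓ : ∀ {n} → Mult n → ℚᵘ → Set
IsΓ {n} m γ =
  (Σ (Subset n) λ T → OddSub T × γ Q.≃ t m T) ×
  (∀ (T : Subset n) → OddSub T → t m T Q.≤ γ)

-- Shrinking.  The vertex set of G_S is (V ∖ S) ∪ {s}; we realise it as
-- Fin (suc k), where zero is the new vertex s and suc i is the i-th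
-- vertex (in increasing order) of the complement of S.
outList : ∀ {n} → Subset n → List (Fin n)
outList {n} S = filter (λ v → lookup S v Data.Bool.≟ false) (allFin n)
  where import Data.Bool

shrinkSize : ∀ {n} → Subset n → ℕ
shrinkSize S = suc (length (outList S))

outVert : ∀ {n} (S : Subset n) → Fin (length (outList S)) → Fin n
outVert S i = L.lookup (outList S) i

toS : ∀ {n} → Mult n → Subset n → Fin n → ℕ
toS {n} m S u = ∑ n (λ w → [ w ∈ S ]· m u w)

shrink : ∀ {n} → Mult n → (S : Subset n) → Mult (shrinkSize S)
shrink m S zero    zero    = 0
shrink m S zero    (suc j) = toS m S (outVert S j)
shrink m S (suc i) zero    = toS m S (outVert S i)
shrink m S (suc i) (suc j) = m (outVert S i) (outVert S j)

-- Write e(X) = 2 e(⟨X⟩) and a = |A|.  In a Δ-regular graph e(X) + e(X, X̄) = Δ|X|,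
-- so Δ-fullness of ⟨S⟩ bounds the number of S–S̄ edges, the degree of the new vertex
-- of both G_S and G_S̄, by Δ.  Since n is even, S̄ is odd and has the same excess
-- as S.  For A ∈ {S, S̄}, an odd T ⊆ V(G_A) avoiding the new vertex is an odd set
-- of G; one containing it expands to X = A ∪ (T − s), with e(X) = e_{G_A}(T) + e(A)
-- and |X| = a + |T| − 1.  If t(T) > Δ, then X would be Δ-overfull with larger excess
-- than A, contradicting maximality; hence t(T) ≤ Δ ≤ t(S) ≤ Γ(G).
module Submission where

open import Defs
open import Data.Bool using (Bool; true; false; not; _∧_; _∨_; if_then_else_)
import Data.Bool as Bool
open import Data.Bool.Properties using (not-involutive; not-¬; ∨-identityʳ; ∨-zeroʳ)
open import Data.Nat using (ℕ; zero; suc; _+_; _*_; _∸_; _≤_; z≤n; s≤s; s≤s⁻¹)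
open import Data.Nat.Properties hiding (_≟_)
open import Data.Nat.Divisibility using (_∣_; divides; _∣0; ∣m+n∣m⇒∣n; ∣m∣n⇒∣m+n)
open import Data.Nat.Solver using (module +-*-Solver)
open import Algebra.Properties.CommutativeSemigroup +-commutativeSemigroup
  using () renaming (interchange to +-interchange; x∙yz≈y∙xz to +-exchange)
open import Algebra.Properties.CommutativeSemigroup *-commutativeSemigroup
  using () renaming (x∙yz≈y∙xz to *-exchange)
import Data.Integer as ℤ
import Data.Integer.Properties as ℤP
open import Data.Integer.Solver using () renaming (module +-*-Solver to ℤ-Solver)
open import Data.Rational.Unnormalised using (ℚᵘ; mkℚᵘ; *≤*)
import Data.Rational.Unnormalised as Q
import Data.Rational.Unnormalised.Properties as ℚᵘP
open import Data.Fin using (Fin; zero; suc; toℕ; _≟_)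
open import Data.Fin.Properties using (toℕ-injective)
open import Data.Fin.Subset using (Subset; ∣_∣; ∁)
open import Data.Fin.Subset.Properties using (∣p∣≤n; ∣∁p∣≡n∸∣p∣)
open import Data.Vec using (Vec; lookup; _∷_; []; replicate; tabulate)
open import Data.Vec.Properties using (lookup-map; lookup-replicate; lookup∘tabulate)
open import Data.List using (List; length; allFin) renaming (_∷_ to _∷ₗ_; [] to []ₗ)
import Data.List as List
open import Data.List.Relation.Unary.All using (All) renaming (_∷_ to _∷ᵃ_; [] to []ᵃ)
open import Data.List.Relation.Unary.Any using (here; there)
open import Data.List.Relation.Unary.AllPairs using () renaming (_∷_ to _∷ᵖ_)
open import Data.List.Membership.Propositional using (_∈_)
open import Data.List.Membership.Propositional.Properties using (∈-filter⁺; ∈-filter⁻; ∈-allFin)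
open import Data.List.Relation.Unary.Unique.Propositional using (Unique)
open import Data.List.Relation.Unary.Unique.Propositional.Properties using (filter⁺; allFin⁺)
open import Data.Product using (_×_; _,_; proj₁; proj₂)
open import Data.Sum using (_⊎_; inj₁; inj₂)
open import Data.Empty using (⊥-elim)
open import Relation.Nullary using (Dec; yes; no; does)
open import Relation.Nullary.Decidable using (⌊_⌋)
open import Relation.Binary.PropositionalEquality
open import Function using (_∘_)


χ : Bool → ℕ
χ true  = 1
χ false = 0

𝟙 : ∀ {n} → (Fin n → Bool) → Fin n → ℕ
𝟙 p v = χ (p v)

χ-not : ∀ b → χ b + χ (not b) ≡ 1
χ-not true  = refl
χ-not false = refl

χ-idem : ∀ b x → χ b * (χ b * x) ≡ χ b * x
χ-idem true  x = cong (_+ 0) (+-identityʳ x)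
χ-idem false x = refl

[∈]·-χ : ∀ {n} (v : Fin n) S x → [ v ∈ S ]· x ≡ 𝟙 (lookup S) v * x
[∈]·-χ v S x with lookup S v
... | true  = sym (+-identityʳ x)
... | false = refl

∑-cong : ∀ n {f g : Fin n → ℕ} → (∀ i → f i ≡ g i) → ∑ n f ≡ ∑ n g
∑-cong zero    _ = refl
∑-cong (suc n) e = cong₂ _+_ (e zero) (∑-cong n (e ∘ suc))

∑-0 : ∀ n → ∑ n (λ _ → 0) ≡ 0
∑-0 zero    = refl
∑-0 (suc n) = ∑-0 n

∑-+ : ∀ n (f g : Fin n → ℕ) → ∑ n (λ i → f i + g i) ≡ ∑ n f + ∑ n g
∑-+ zero    f g = refl
∑-+ (suc n) f g = trans (cong (f zero + g zero +_) (∑-+ n (f ∘ suc) (g ∘ suc)))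
  (+-interchange (f zero) (g zero) _ _)

∑-*ˡ : ∀ n c (f : Fin n → ℕ) → ∑ n (λ i → c * f i) ≡ c * ∑ n f
∑-*ˡ zero    c f = sym (*-zeroʳ c)
∑-*ˡ (suc n) c f = trans (cong (c * f zero +_) (∑-*ˡ n c (f ∘ suc))) (sym (*-distribˡ-+ c (f zero) _))

∑-comm : ∀ n m (f : Fin n → Fin m → ℕ) → ∑ n (λ i → ∑ m (f i)) ≡ ∑ m (λ j → ∑ n (λ i → f i j))
∑-comm zero    m f = sym (∑-0 m)
∑-comm (suc n) m f = trans (cong (∑ m (f zero) +_) (∑-comm n m (f ∘ suc))) (sym (∑-+ m (f zero) _))

∣S∣≡∑𝟙 : ∀ {n} (S : Subset n) → ∣ S ∣ ≡ ∑ n (𝟙 (lookup S))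
∣S∣≡∑𝟙 []          = refl
∣S∣≡∑𝟙 (true ∷ S)  = cong suc (∣S∣≡∑𝟙 S)
∣S∣≡∑𝟙 (false ∷ S) = ∣S∣≡∑𝟙 S

arcs : ∀ {n} → Mult n → (Fin n → ℕ) → (Fin n → ℕ) → ℕ
arcs {n} m p q = ∑ n (λ u → p u * ∑ n (λ v → q v * m u v))

module _ {n} (m : Mult n) where

  arcs-cong : ∀ {p p′ q q′} → (∀ v → p v ≡ p′ v) → (∀ v → q v ≡ q′ v) → arcs m p q ≡ arcs m p′ q′
  arcs-cong p≗ q≗ = ∑-cong n (λ u → cong₂ _*_ (p≗ u) (∑-cong n (λ v → cong (_* m u v) (q≗ v))))

  arcs-+ˡ : ∀ p p′ q → arcs m (λ v → p v + p′ v) q ≡ arcs m p q + arcs m p′ q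
  arcs-+ˡ p p′ q = trans (∑-cong n (λ u → *-distribʳ-+ _ (p u) (p′ u))) (∑-+ n _ _)

  arcs-*ˡ : ∀ c p q → arcs m (λ v → c * p v) q ≡ c * arcs m p q
  arcs-*ˡ c p q = trans (∑-cong n (λ u → *-assoc c (p u) _)) (∑-*ˡ n c _)

  arcs-+ʳ : ∀ p q q′ → arcs m p (λ v → q v + q′ v) ≡ arcs m p q + arcs m p q′
  arcs-+ʳ p q q′ = trans (∑-cong n inner) (∑-+ n _ _)
    where
    inner : ∀ u → p u * ∑ n (λ v → (q v + q′ v) * m u v)
                ≡ p u * ∑ n (λ v → q v * m u v) + p u * ∑ n (λ v → q′ v * m u v)
    inner u = trans (cong (p u *_) (trans (∑-cong n (λ v → *-distribʳ-+ (m u v) (q v) (q′ v))) (∑-+ n _ _)))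
                    (*-distribˡ-+ (p u) _ _)

  arcs-*ʳ : ∀ c p q → arcs m p (λ v → c * q v) ≡ c * arcs m p q
  arcs-*ʳ c p q = trans (∑-cong n inner) (∑-*ˡ n c _)
    where
    inner : ∀ u → p u * ∑ n (λ v → c * q v * m u v) ≡ c * (p u * ∑ n (λ v → q v * m u v))
    inner u = begin
      p u * ∑ n (λ v → c * q v * m u v)    ≡⟨ cong (p u *_) (trans (∑-cong n (λ v → *-assoc c (q v) _)) (∑-*ˡ n c _)) ⟩
      p u * (c * ∑ n (λ v → q v * m u v))  ≡⟨ *-exchange (p u) c _ ⟩
      c * (p u * ∑ n (λ v → q v * m u v))  ∎
      where open ≡-Reasoning

  arcs-comm : (∀ u v → m u v ≡ m v u) → ∀ p q → arcs m p q ≡ arcs m q p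
  arcs-comm sym-m p q = begin
    ∑ n (λ u → p u * ∑ n (λ v → q v * m u v))    ≡⟨ ∑-cong n (λ u → sym (∑-*ˡ n (p u) _)) ⟩
    ∑ n (λ u → ∑ n (λ v → p u * (q v * m u v)))  ≡⟨ ∑-comm n n _ ⟩
    ∑ n (λ v → ∑ n (λ u → p u * (q v * m u v)))  ≡⟨ ∑-cong n (λ v → ∑-cong n (λ u → trans (*-exchange (p u) (q v) _) (cong (λ x → q v * (p u * x)) (sym-m u v)))) ⟩
    ∑ n (λ v → ∑ n (λ u → q v * (p u * m v u)))  ≡⟨ ∑-cong n (λ v → ∑-*ˡ n (q v) _) ⟩
    ∑ n (λ v → q v * ∑ n (λ u → p u * m v u))    ∎
    where open ≡-Reasoning

  arcs-complement : ∀ p (S : Subset n) →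
    arcs m p (𝟙 (lookup S)) + arcs m p (𝟙 (not ∘ lookup S)) ≡ ∑ n (λ u → p u * deg m u)
  arcs-complement p S = begin
    arcs m p (𝟙 (lookup S)) + arcs m p (𝟙 (not ∘ lookup S))     ≡⟨ sym (arcs-+ʳ p (𝟙 (lookup S)) (𝟙 (not ∘ lookup S))) ⟩
    arcs m p (λ v → 𝟙 (lookup S) v + 𝟙 (not ∘ lookup S) v)    ≡⟨ arcs-cong {p} (λ _ → refl) (χ-not ∘ lookup S) ⟩
    arcs m p (λ _ → 1)                                         ≡⟨ ∑-cong n (λ u → cong (p u *_) (∑-cong n (λ v → +-identityʳ (m u v)))) ⟩
    ∑ n (λ u → p u * deg m u)                                  ∎
    where open ≡-Reasoning

2*eInd≡arcs : ∀ {n} (m : Mult n) → IsMultigraph m → ∀ S →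
  2 * eInd m S ≡ arcs m (𝟙 (lookup S)) (𝟙 (lookup S))
2*eInd≡arcs {n} m (sym-m , loopless) S = begin
  2 * eInd m S                                         ≡⟨ cong (eInd m S +_) (+-identityʳ _) ⟩
  eInd m S + eInd m S                                  ≡⟨ cong (eInd m S +_) (∑-comm n n below) ⟩
  ∑ n (λ u → ∑ n (below u)) + ∑ n (λ u → ∑ n (λ v → below v u))
                                                       ≡⟨ sym (∑-+ n _ _) ⟩
  ∑ n (λ u → ∑ n (below u) + ∑ n (λ v → below v u))    ≡⟨ ∑-cong n (λ u → sym (∑-+ n _ _)) ⟩
  ∑ n (λ u → ∑ n (λ v → below u v + below v u))        ≡⟨ ∑-cong n (λ u → ∑-cong n (λ v → sym (split u v))) ⟩
  ∑ n (λ u → ∑ n (λ v → w u v))                        ≡⟨ ∑-cong n (λ u → trans (∑-cong n (w≡ u)) (∑-*ˡ n (𝟙 (lookup S) u) (λ v → 𝟙 (lookup S) v * m u v))) ⟩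
  arcs m (𝟙 (lookup S)) (𝟙 (lookup S))                 ∎
  where
  open ≡-Reasoning
  w : Fin n → Fin n → ℕ
  w u v = [ u ∈ S ]· ([ v ∈ S ]· m u v)

  below : Fin n → Fin n → ℕ
  below u v = if ⌊ toℕ u <? toℕ v ⌋ then w u v else 0

  w≡ : ∀ u v → w u v ≡ 𝟙 (lookup S) u * (𝟙 (lookup S) v * m u v)
  w≡ u v = trans ([∈]·-χ u S _) (cong (𝟙 (lookup S) u *_) ([∈]·-χ v S _))

  w-sym : ∀ u v → w u v ≡ w v u
  w-sym u v = begin
    w u v                                               ≡⟨ w≡ u v ⟩
    𝟙 (lookup S) u * (𝟙 (lookup S) v * m u v)           ≡⟨ cong (λ x → 𝟙 (lookup S) u * (𝟙 (lookup S) v * x)) (sym-m u v) ⟩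
    𝟙 (lookup S) u * (𝟙 (lookup S) v * m v u)           ≡⟨ *-exchange (𝟙 (lookup S) u) (𝟙 (lookup S) v) (m v u) ⟩
    𝟙 (lookup S) v * (𝟙 (lookup S) u * m v u)           ≡⟨ sym (w≡ v u) ⟩
    w v u                                               ∎

  w-diag : ∀ u → w u u ≡ 0
  w-diag u = begin
    w u u                                         ≡⟨ w≡ u u ⟩
    𝟙 (lookup S) u * (𝟙 (lookup S) u * m u u)     ≡⟨ cong (λ x → 𝟙 (lookup S) u * (𝟙 (lookup S) u * x)) (loopless u) ⟩
    𝟙 (lookup S) u * (𝟙 (lookup S) u * 0)         ≡⟨ cong (𝟙 (lookup S) u *_) (*-zeroʳ (𝟙 (lookup S) u)) ⟩
    𝟙 (lookup S) u * 0                            ≡⟨ *-zeroʳ (𝟙 (lookup S) u) ⟩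
    0                                             ∎

  split : ∀ u v → w u v ≡ below u v + below v u
  split u v with toℕ u <? toℕ v | toℕ v <? toℕ u
  ... | yes u<v | yes v<u = ⊥-elim (<-asym u<v v<u)
  ... | yes _   | no _    = sym (+-identityʳ _)
  ... | no _    | yes _   = w-sym u v
  ... | no u≮v  | no v≮u  = trans (cong (w u) (sym u≡v)) (w-diag u)
    where
    u≡v : u ≡ v
    u≡v = toℕ-injective (≤-antisym (≮⇒≥ v≮u) (≮⇒≥ u≮v))

-- The entries of xs whose flag in bs is set; for xs = outList A this reads a subset of
-- V(G_A) − s back as a subset of V(G).
flagged : ∀ {n} (xs : List (Fin n)) → Vec Bool (length xs) → Fin n → Bool
flagged []ₗ        []       v = false
flagged (x ∷ₗ xs) (b ∷ bs) v = if does (v ≟ x) then b else flagged xs bs v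

flagged-∉ : ∀ {n} {x : Fin n} xs bs → All (x ≢_) xs → flagged xs bs x ≡ false
flagged-∉         []ₗ        []       []ᵃ               = refl
flagged-∉ {x = x} (y ∷ₗ ys) (b ∷ bs) (x≢y ∷ᵃ x∉ys) with x ≟ y
... | yes x≡y = ⊥-elim (x≢y x≡y)
... | no  _   = flagged-∉ ys bs x∉ys

flagged⇒∈ : ∀ {n} (xs : List (Fin n)) bs v → flagged xs bs v ≡ true → v ∈ xs
flagged⇒∈ []ₗ        []       v ()
flagged⇒∈ (x ∷ₗ xs) (b ∷ bs) v flag with v ≟ x
... | yes v≡x = here v≡x
... | no  _   = there (flagged⇒∈ xs bs v flag)

∈⇒flagged-all : ∀ {n} (xs : List (Fin n)) v → v ∈ xs → flagged xs (replicate (length xs) true) v ≡ true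
∈⇒flagged-all (x ∷ₗ xs) v v∈xs with v ≟ x | v∈xs
... | yes _   | _          = refl
... | no  v≢x | here v≡x   = ⊥-elim (v≢x v≡x)
... | no  _   | there v∈xs′ = ∈⇒flagged-all xs v v∈xs′

∑-override : ∀ n (x : Fin n) c (g : Fin n → ℕ) → g x ≡ 0 →
  ∑ n (λ v → if does (v ≟ x) then c else g v) ≡ c + ∑ n g
∑-override (suc n) zero    c g gx = cong (λ z → c + (z + ∑ n (g ∘ suc))) (sym gx)
∑-override (suc n) (suc x) c g gx = trans (cong (g zero +_) (∑-override n x c (g ∘ suc) gx)) (+-exchange (g zero) c _)

∑-flagged : ∀ {n} (xs : List (Fin n)) → Unique xs → (bs : Vec Bool (length xs)) (f : Fin n → ℕ) →
  ∑ n (λ v → 𝟙 (flagged xs bs) v * f v) ≡ ∑ (length xs) (λ i → 𝟙 (lookup bs) i * f (List.lookup xs i))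
∑-flagged {n} []ₗ        _                []       f = ∑-0 n
∑-flagged {n} (x ∷ₗ xs) (x∉xs ∷ᵖ unique) (b ∷ bs) f = begin
  ∑ n (λ v → 𝟙 (flagged (x ∷ₗ xs) (b ∷ bs)) v * f v)              ≡⟨ ∑-cong n at ⟩
  ∑ n (λ v → if does (v ≟ x) then χ b * f x else rest v)           ≡⟨ ∑-override n x (χ b * f x) rest rest-x ⟩
  χ b * f x + ∑ n rest                                             ≡⟨ cong (χ b * f x +_) (∑-flagged xs unique bs f) ⟩
  χ b * f x + ∑ (length xs) (λ i → 𝟙 (lookup bs) i * f (List.lookup xs i)) ∎
  where
  open ≡-Reasoning
  rest : Fin n → ℕ
  rest v = 𝟙 (flagged xs bs) v * f v

  rest-x : rest x ≡ 0
  rest-x rewrite flagged-∉ xs bs x∉xs = refl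

  at : ∀ v → 𝟙 (flagged (x ∷ₗ xs) (b ∷ bs)) v * f v ≡ (if does (v ≟ x) then χ b * f x else rest v)
  at v with v ≟ x
  ... | yes refl = refl
  ... | no  _    = refl

module Shrinking {n} (G : Mult n) (A : Subset n) where

  private
    outs : List (Fin n)
    outs = outList A

    N : ℕ
    N = length outs

    H : Mult (suc N)
    H = shrink G A

    a : Fin n → ℕ
    a = 𝟙 (lookup A)

    row : (Fin n → ℕ) → Fin n → ℕ
    row q u = ∑ n (λ w → q w * G u w)

    outside? : ∀ v → Dec (lookup A v ≡ false)
    outside? v = lookup A v Bool.≟ false

  outs-unique : Unique outs
  outs-unique = filter⁺ outside? (allFin⁺ n)

  flagged-outs-∉ : ∀ bs v → flagged outs bs v ≡ true → lookup A v ≡ false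
  flagged-outs-∉ bs v flag = proj₂ (∈-filter⁻ outside? {xs = allFin n} (flagged⇒∈ outs bs v flag))

  flagged-all-outs : ∀ v → flagged outs (replicate N true) v ≡ not (lookup A v)
  flagged-all-outs v with lookup A v in v∉A
  ... | false = ∈⇒flagged-all outs v (∈-filter⁺ outside? (∈-allFin v) v∉A)
  ... | true with flagged outs (replicate N true) v in flag
  ...   | false = refl
  ...   | true  = ⊥-elim (not-¬ v∉A (flagged-outs-∉ (replicate N true) v flag))

  ∑-outs : ∀ bs (f : Fin n → ℕ) →
    ∑ N (λ i → 𝟙 (lookup bs) i * f (outVert A i)) ≡ ∑ n (λ v → 𝟙 (flagged outs bs) v * f v)
  ∑-outs bs f = sym (∑-flagged outs outs-unique bs f)

  ∑-outside : ∀ (f : Fin n → ℕ) → ∑ N (f ∘ outVert A) ≡ ∑ n (λ v → 𝟙 (not ∘ lookup A) v * f v)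
  ∑-outside f = begin
    ∑ N (f ∘ outVert A)                                                 ≡⟨ ∑-cong N (λ i → sym (+-identityʳ _)) ⟩
    ∑ N (λ i → 1 * f (outVert A i))                                     ≡⟨ ∑-cong N (λ i → cong (λ b → χ b * f (outVert A i)) (sym (lookup-replicate i true))) ⟩
    ∑ N (λ i → 𝟙 (lookup (replicate N true)) i * f (outVert A i))      ≡⟨ ∑-outs (replicate N true) f ⟩
    ∑ n (λ v → 𝟙 (flagged outs (replicate N true)) v * f v)            ≡⟨ ∑-cong n (λ v → cong (λ b → χ b * f v) (flagged-all-outs v)) ⟩
    ∑ n (λ v → 𝟙 (not ∘ lookup A) v * f v)                              ∎
    where open ≡-Reasoning

  toS≡row : ∀ u → toS G A u ≡ row a u
  toS≡row u = ∑-cong n (λ w → [∈]·-χ w A (G u w))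

  shrink-isMultigraph : IsMultigraph G → IsMultigraph H
  shrink-isMultigraph (sym-G , loopless) = sym-H , loopless-H
    where
    sym-H : ∀ u v → H u v ≡ H v u
    sym-H zero    zero    = refl
    sym-H zero    (suc j) = refl
    sym-H (suc i) zero    = refl
    sym-H (suc i) (suc j) = sym-G _ _
    loopless-H : ∀ u → H u u ≡ 0
    loopless-H zero    = refl
    loopless-H (suc i) = loopless _

  deg-new : deg H zero ≡ arcs G (𝟙 (not ∘ lookup A)) a
  deg-new = trans (∑-outside (toS G A)) (∑-cong n (λ v → cong (𝟙 (not ∘ lookup A) v *_) (toS≡row v)))

  deg-old : ∀ i → deg H (suc i) ≡ deg G (outVert A i)
  deg-old i = begin
    toS G A u + ∑ N (G u ∘ outVert A)                                 ≡⟨ cong₂ _+_ (toS≡row u) (∑-outside (G u)) ⟩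
    row a u + row (𝟙 (not ∘ lookup A)) u                              ≡⟨ sym (∑-+ n _ _) ⟩
    ∑ n (λ w → a w * G u w + 𝟙 (not ∘ lookup A) w * G u w)           ≡⟨ ∑-cong n (λ w → sym (*-distribʳ-+ (G u w) (a w) _)) ⟩
    ∑ n (λ w → (a w + 𝟙 (not ∘ lookup A) w) * G u w)                 ≡⟨ ∑-cong n (λ w → trans (cong (_* G u w) (χ-not (lookup A w))) (+-identityʳ _)) ⟩
    deg G u                                                           ∎
    where
    open ≡-Reasoning
    u : Fin n
    u = outVert A i

  -- the set of G corresponding to T ⊆ V(G_A): T − s, together with A when s ∈ T
  expand : Subset (suc N) → Subset n
  expand (b ∷ bs) = tabulate (λ v → (b ∧ lookup A v) ∨ flagged outs bs v)

  𝟙-expand : ∀ b bs v → 𝟙 (lookup (expand (b ∷ bs))) v ≡ χ b * a v + 𝟙 (flagged outs bs) v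
  𝟙-expand b bs v rewrite lookup∘tabulate (λ v → (b ∧ lookup A v) ∨ flagged outs bs v) v
    with flagged outs bs v in flag
  ... | true  rewrite flagged-outs-∉ bs v flag | ∨-zeroʳ (b ∧ false) = cong (_+ 1) (sym (*-zeroʳ (χ b)))
  ... | false rewrite ∨-identityʳ (b ∧ lookup A v) = sym (trans (+-identityʳ _) (χ-∧ b (lookup A v)))
    where
    χ-∧ : ∀ x y → χ x * χ y ≡ χ (x ∧ y)
    χ-∧ true  true  = refl
    χ-∧ true  false = refl
    χ-∧ false y     = refl

  ∣expand∣ : ∀ b bs → ∣ expand (b ∷ bs) ∣ ≡ χ b * ∣ A ∣ + ∣ bs ∣
  ∣expand∣ b bs = begin
    ∣ expand (b ∷ bs) ∣                                          ≡⟨ ∣S∣≡∑𝟙 (expand (b ∷ bs)) ⟩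
    ∑ n (𝟙 (lookup (expand (b ∷ bs))))                           ≡⟨ ∑-cong n (𝟙-expand b bs) ⟩
    ∑ n (λ v → χ b * a v + 𝟙 (flagged outs bs) v)                ≡⟨ ∑-+ n _ _ ⟩
    ∑ n (λ v → χ b * a v) + ∑ n (𝟙 (flagged outs bs))            ≡⟨ cong₂ _+_ (∑-*ˡ n (χ b) a) (∑-cong n (λ v → sym (*-identityʳ _))) ⟩
    χ b * ∑ n a + ∑ n (λ v → 𝟙 (flagged outs bs) v * 1)          ≡⟨ cong₂ _+_ (cong (χ b *_) (sym (∣S∣≡∑𝟙 A))) (sym (∑-outs bs (λ _ → 1))) ⟩
    χ b * ∣ A ∣ + ∑ N (λ i → 𝟙 (lookup bs) i * 1)                ≡⟨ cong (χ b * ∣ A ∣ +_) (trans (∑-cong N (λ i → *-identityʳ _)) (sym (∣S∣≡∑𝟙 bs))) ⟩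
    χ b * ∣ A ∣ + ∣ bs ∣                                          ∎
    where open ≡-Reasoning

  arcs-expand : (∀ u v → G u v ≡ G v u) → ∀ b bs →
    arcs H (𝟙 (lookup (b ∷ bs))) (𝟙 (lookup (b ∷ bs))) + χ b * arcs G a a
      ≡ arcs G (𝟙 (lookup (expand (b ∷ bs)))) (𝟙 (lookup (expand (b ∷ bs))))
  arcs-expand sym-G b bs = begin
    arcs H τ τ + χ b * arcs G a a                                  ≡⟨ cong (_+ χ b * arcs G a a) arcs-H ⟩
    χ b * (χ b * 0 + arcs G l a) + arcs G l r + χ b * arcs G a a   ≡⟨ regroup (arcs G a a) (arcs G l a) (arcs G l r) ⟩
    χ b * (χ b * arcs G a a + arcs G l a) + arcs G l r             ≡⟨ sym arcs-r ⟩
    arcs G r r                                                     ≡⟨ arcs-cong G (sym ∘ 𝟙-expand b bs) (sym ∘ 𝟙-expand b bs) ⟩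
    arcs G (𝟙 (lookup (expand (b ∷ bs)))) (𝟙 (lookup (expand (b ∷ bs)))) ∎
    where
    open ≡-Reasoning
    τ : Fin (suc N) → ℕ
    τ = 𝟙 (lookup (b ∷ bs))
    l : Fin n → ℕ
    l = 𝟙 (flagged outs bs)
    r : Fin n → ℕ
    r v = χ b * a v + l v

    row-r : ∀ u → χ b * toS G A u + ∑ N (λ j → 𝟙 (lookup bs) j * G u (outVert A j)) ≡ row r u
    row-r u = begin
      χ b * toS G A u + ∑ N (λ j → 𝟙 (lookup bs) j * G u (outVert A j))  ≡⟨ cong₂ _+_ (cong (χ b *_) (toS≡row u)) (∑-outs bs (G u)) ⟩
      χ b * row a u + row l u                                            ≡⟨ cong (_+ row l u) (sym (∑-*ˡ n (χ b) _)) ⟩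
      ∑ n (λ w → χ b * (a w * G u w)) + row l u                          ≡⟨ sym (∑-+ n _ _) ⟩
      ∑ n (λ w → χ b * (a w * G u w) + l w * G u w)                      ≡⟨ ∑-cong n (λ w → cong (_+ l w * G u w) (sym (*-assoc (χ b) (a w) (G u w)))) ⟩
      ∑ n (λ w → χ b * a w * G u w + l w * G u w)                        ≡⟨ ∑-cong n (λ w → sym (*-distribʳ-+ (G u w) (χ b * a w) (l w))) ⟩
      row r u                                                            ∎

    arcs-H : arcs H τ τ ≡ χ b * (χ b * 0 + arcs G l a) + arcs G l r
    arcs-H = cong₂ (λ x y → χ b * (χ b * 0 + x) + y)
      (trans (∑-outs bs (toS G A)) (∑-cong n (λ v → cong (l v *_) (toS≡row v))))
      (trans (∑-cong N (λ i → cong (𝟙 (lookup bs) i *_) (row-r (outVert A i)))) (∑-outs bs (row r)))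

    arcs-r : arcs G r r ≡ χ b * (χ b * arcs G a a + arcs G l a) + arcs G l r
    arcs-r = begin
      arcs G r r                                          ≡⟨ arcs-+ˡ G (λ v → χ b * a v) l r ⟩
      arcs G (λ v → χ b * a v) r + arcs G l r             ≡⟨ cong (_+ arcs G l r) (arcs-*ˡ G (χ b) a r) ⟩
      χ b * arcs G a r + arcs G l r                       ≡⟨ cong (λ x → χ b * x + arcs G l r) (arcs-+ʳ G a (λ v → χ b * a v) l) ⟩
      χ b * (arcs G a (λ v → χ b * a v) + arcs G a l) + arcs G l r
                                                          ≡⟨ cong₂ (λ x y → χ b * (x + y) + arcs G l r) (arcs-*ʳ G (χ b) a a) (arcs-comm G sym-G a l) ⟩
      χ b * (χ b * arcs G a a + arcs G l a) + arcs G l r  ∎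

    regroup : ∀ x y z → χ b * (χ b * 0 + y) + z + χ b * x ≡ χ b * (χ b * x + y) + z
    regroup x y z = begin
      χ b * (χ b * 0 + y) + z + χ b * x    ≡⟨ cong (λ w → χ b * (w + y) + z + χ b * x) (*-zeroʳ (χ b)) ⟩
      χ b * y + z + χ b * x                ≡⟨ solve 4 (λ c x y z → c :* y :+ z :+ c :* x := c :* x :+ c :* y :+ z) refl (χ b) x y z ⟩
      χ b * x + χ b * y + z                ≡⟨ cong (λ w → w + χ b * y + z) (sym (χ-idem b x)) ⟩
      χ b * (χ b * x) + χ b * y + z        ≡⟨ cong (_+ z) (sym (*-distribˡ-+ (χ b) (χ b * x) y)) ⟩
      χ b * (χ b * x + y) + z              ∎
      where open +-*-Solver

  eInd-expand : IsMultigraph G → ∀ b bs →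
    2 * eInd H (b ∷ bs) + χ b * (2 * eInd G A) ≡ 2 * eInd G (expand (b ∷ bs))
  eInd-expand isG b bs = begin
    2 * eInd H (b ∷ bs) + χ b * (2 * eInd G A)
      ≡⟨ cong₂ (λ x y → x + χ b * y) (2*eInd≡arcs H (shrink-isMultigraph isG) (b ∷ bs)) (2*eInd≡arcs G isG A) ⟩
    arcs H (𝟙 (lookup (b ∷ bs))) (𝟙 (lookup (b ∷ bs))) + χ b * arcs G a a
      ≡⟨ arcs-expand (proj₁ isG) b bs ⟩
    arcs G (𝟙 (lookup (expand (b ∷ bs)))) (𝟙 (lookup (expand (b ∷ bs))))
      ≡⟨ sym (2*eInd≡arcs G isG (expand (b ∷ bs))) ⟩
    2 * eInd G (expand (b ∷ bs)) ∎
    where open ≡-Reasoning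

-- mkℚᵘ (+ e) (x ∸ 2) denotes e / (x − 1), the shape of t; adding Δ to both sides avoids ∸
ℕ→ℚᵘ≤mkℚᵘ⇒ : ∀ {Δ e} x → 2 ≤ x → ℕ→ℚᵘ Δ Q.≤ mkℚᵘ (ℤ.+ e) (x ∸ 2) → Δ * x ≤ Δ + e
ℕ→ℚᵘ≤mkℚᵘ⇒ (suc zero) (s≤s ()) _
ℕ→ℚᵘ≤mkℚᵘ⇒ {Δ} {e} (suc (suc k)) _ (*≤* p) = begin
  Δ * suc (suc k)   ≡⟨ *-suc Δ (suc k) ⟩
  Δ + Δ * suc k     ≤⟨ +-monoʳ-≤ Δ (ℤP.drop‿+≤+ (subst₂ ℤ._≤_ (sym (ℤP.pos-* Δ (suc k))) (ℤP.*-identityʳ (ℤ.+ e)) p)) ⟩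
  Δ + e             ∎
  where open ≤-Reasoning

ℕ→ℚᵘ≤mkℚᵘ⇐ : ∀ {Δ e} x → 2 ≤ x → Δ * x ≤ Δ + e → ℕ→ℚᵘ Δ Q.≤ mkℚᵘ (ℤ.+ e) (x ∸ 2)
ℕ→ℚᵘ≤mkℚᵘ⇐ (suc zero) (s≤s ()) _
ℕ→ℚᵘ≤mkℚᵘ⇐ {Δ} {e} (suc (suc k)) _ p =
  *≤* (subst₂ ℤ._≤_ (ℤP.pos-* Δ (suc k)) (sym (ℤP.*-identityʳ (ℤ.+ e)))
    (ℤ.+≤+ (+-cancelˡ-≤ Δ _ _ (subst (_≤ Δ + e) (*-suc Δ (suc k)) p))))

mkℚᵘ≤ℕ→ℚᵘ : ∀ {Δ e} x → 2 ≤ x → Δ + e ≤ Δ * x → mkℚᵘ (ℤ.+ e) (x ∸ 2) Q.≤ ℕ→ℚᵘ Δ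
mkℚᵘ≤ℕ→ℚᵘ (suc zero) (s≤s ()) _
mkℚᵘ≤ℕ→ℚᵘ {Δ} {e} (suc (suc k)) _ p =
  *≤* (subst₂ ℤ._≤_ (sym (ℤP.*-identityʳ (ℤ.+ e))) (ℤP.pos-* Δ (suc k))
    (ℤ.+≤+ (+-cancelˡ-≤ Δ _ _ (subst (Δ + e ≤_) (*-suc Δ (suc k)) p))))

ex-≤⇒ : ∀ a b c d → mkℚᵘ (ℤ.+ a ℤ.- ℤ.+ b) 1 Q.≤ mkℚᵘ (ℤ.+ c ℤ.- ℤ.+ d) 1 → a + d ≤ c + b
ex-≤⇒ a b c d (*≤* p) = ℤP.drop‿+≤+ (subst₂ ℤ._≤_ lhs rhs (ℤP.+-monoˡ-≤ (ℤ.+ b ℤ.+ ℤ.+ d) a-b≤c-d))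
  where
  open ℤ-Solver
  a-b≤c-d : ℤ.+ a ℤ.- ℤ.+ b ℤ.≤ ℤ.+ c ℤ.- ℤ.+ d
  a-b≤c-d = ℤP.*-cancelʳ-≤-pos _ _ (ℤ.+ 2) p
  lhs : (ℤ.+ a ℤ.- ℤ.+ b) ℤ.+ (ℤ.+ b ℤ.+ ℤ.+ d) ≡ ℤ.+ (a + d)
  lhs = trans (solve 3 (λ x y z → (x :- y) :+ (y :+ z) := x :+ z) refl (ℤ.+ a) (ℤ.+ b) (ℤ.+ d)) (sym (ℤP.pos-+ a d))
  rhs : (ℤ.+ c ℤ.- ℤ.+ d) ℤ.+ (ℤ.+ b ℤ.+ ℤ.+ d) ≡ ℤ.+ (c + b)
  rhs = trans (solve 3 (λ x y z → (x :- z) :+ (y :+ z) := x :+ y) refl (ℤ.+ c) (ℤ.+ b) (ℤ.+ d)) (sym (ℤP.pos-+ c b))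

even⊎even-suc : ∀ k → Even k ⊎ Even (suc k)
even⊎even-suc zero    = inj₁ (2 ∣0)
even⊎even-suc (suc k) with even⊎even-suc k
... | inj₁ 2∣k  = inj₂ (∣m∣n⇒∣m+n (divides 1 refl) 2∣k)
... | inj₂ 2∣1+k = inj₁ 2∣1+k

odd-suc⇒even : ∀ {k} → Odd (suc k) → Even k
odd-suc⇒even {k} odd with even⊎even-suc k
... | inj₁ even = even
... | inj₂ even = ⊥-elim (odd even)

odd+even⇒odd : ∀ {a k} → Odd a → Even k → Odd (a + k)
odd+even⇒odd {a} {k} odd-a even-k 2∣a+k = odd-a (∣m+n∣m⇒∣n (subst (2 ∣_) (+-comm a k) 2∣a+k) even-k)

odd∧even-sum⇒odd : ∀ {a b} → Odd a → Even (a + b) → Odd b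
odd∧even-sum⇒odd {a} {b} odd-a even-a+b 2∣b = odd-a (∣m+n∣m⇒∣n (subst (2 ∣_) (+-comm a b) even-a+b) 2∣b)

odd⇒1≤ : ∀ {a} → Odd a → 1 ≤ a
odd⇒1≤ {zero}  odd = ⊥-elim (odd (2 ∣0))
odd⇒1≤ {suc a} _   = s≤s z≤n

oddSub⇒2≤ : ∀ {n} (X : Subset n) → OddSub X → 2 ≤ ∣ X ∣
oddSub⇒2≤ X (_ , 3≤∣X∣) = ≤-trans (n≤1+n 2) 3≤∣X∣

*-∸1 : ∀ Δ {x} → 1 ≤ x → Δ * x ≡ Δ + Δ * (x ∸ 1)
*-∸1 Δ {suc y} _ = *-suc Δ y

module MaximumExcess {n} (G : Mult n) (Δ : ℕ) (isG : IsMultigraph G) (regular : Regular G Δ)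
  (S : Subset n) (S-odd : OddSub S) (S-full : FullOrOverfull G S Δ)
  (S-max : ∀ T → OddSub T → FullOrOverfull G T Δ → ex G T Δ Q.≤ ex G S Δ) where

  e : Subset n → ℕ
  e X = 2 * eInd G X

  ∂ : Subset n → ℕ
  ∂ X = arcs G (𝟙 (not ∘ lookup X)) (𝟙 (lookup X))

  e+∂ : ∀ X → e X + ∂ X ≡ Δ * ∣ X ∣
  e+∂ X = begin
    e X + ∂ X                                        ≡⟨ cong₂ _+_ (2*eInd≡arcs G isG X) (arcs-comm G (proj₁ isG) (𝟙 (not ∘ lookup X)) x) ⟩
    arcs G x x + arcs G x (𝟙 (not ∘ lookup X))       ≡⟨ arcs-complement G x X ⟩
    ∑ n (λ u → x u * deg G u)                        ≡⟨ ∑-cong n (λ u → trans (cong (x u *_) (regular u)) (*-comm (x u) Δ)) ⟩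
    ∑ n (λ u → Δ * x u)                              ≡⟨ ∑-*ˡ n Δ x ⟩
    Δ * ∑ n x                                        ≡⟨ cong (Δ *_) (sym (∣S∣≡∑𝟙 X)) ⟩
    Δ * ∣ X ∣                                        ∎
    where
    open ≡-Reasoning
    x : Fin n → ℕ
    x = 𝟙 (lookup X)

  S-full-ℕ : Δ * ∣ S ∣ ≤ Δ + e S
  S-full-ℕ = ℕ→ℚᵘ≤mkℚᵘ⇒ ∣ S ∣ (oddSub⇒2≤ S S-odd) S-full

  S-max-ℕ : ∀ X → OddSub X → Δ * ∣ X ∣ ≤ Δ + e X → e X + Δ * ∣ S ∣ ≤ e S + Δ * ∣ X ∣
  S-max-ℕ X X-odd X-full = begin
    e X + Δ * ∣ S ∣                    ≡⟨ cong (e X +_) (*-∸1 Δ (odd⇒1≤ (proj₁ S-odd))) ⟩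
    e X + (Δ + Δ * (∣ S ∣ ∸ 1))        ≡⟨ +-exchange (e X) Δ _ ⟩
    Δ + (e X + Δ * (∣ S ∣ ∸ 1))        ≤⟨ +-monoʳ-≤ Δ excess≤ ⟩
    Δ + (e S + Δ * (∣ X ∣ ∸ 1))        ≡⟨ +-exchange Δ (e S) _ ⟩
    e S + (Δ + Δ * (∣ X ∣ ∸ 1))        ≡⟨ cong (e S +_) (*-∸1 Δ (odd⇒1≤ (proj₁ X-odd))) ⟨
    e S + Δ * ∣ X ∣                    ∎
    where
    open ≤-Reasoning
    excess≤ : e X + Δ * (∣ S ∣ ∸ 1) ≤ e S + Δ * (∣ X ∣ ∸ 1)
    excess≤ = ex-≤⇒ (e X) (Δ * (∣ X ∣ ∸ 1)) (e S) (Δ * (∣ S ∣ ∸ 1))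
                (S-max X X-odd (ℕ→ℚᵘ≤mkℚᵘ⇐ ∣ X ∣ (oddSub⇒2≤ X X-odd) X-full))

  ∂S≤Δ : ∂ S ≤ Δ
  ∂S≤Δ = +-cancelˡ-≤ (e S) _ _ (begin
    e S + ∂ S      ≡⟨ e+∂ S ⟩
    Δ * ∣ S ∣      ≤⟨ S-full-ℕ ⟩
    Δ + e S        ≡⟨ +-comm Δ (e S) ⟩
    e S + Δ        ∎)
    where open ≤-Reasoning

  ∂∁S≡∂S : ∂ (∁ S) ≡ ∂ S
  ∂∁S≡∂S = trans (arcs-cong G ¬∁S≗S (λ v → cong χ (lookup-map v not S)))
                 (arcs-comm G (proj₁ isG) (𝟙 (lookup S)) (𝟙 (not ∘ lookup S)))
    where
    ¬∁S≗S : ∀ v → 𝟙 (not ∘ lookup (∁ S)) v ≡ 𝟙 (lookup S) v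
    ¬∁S≗S v = cong χ (trans (cong not (lookup-map v not S)) (not-involutive (lookup S v)))

  ∁S-excess : e (∁ S) + Δ * ∣ S ∣ ≡ e S + Δ * ∣ ∁ S ∣
  ∁S-excess = begin
    e (∁ S) + Δ * ∣ S ∣              ≡⟨ cong (e (∁ S) +_) (e+∂ S) ⟨
    e (∁ S) + (e S + ∂ S)            ≡⟨ +-exchange (e (∁ S)) (e S) (∂ S) ⟩
    e S + (e (∁ S) + ∂ S)            ≡⟨ cong (λ d → e S + (e (∁ S) + d)) ∂∁S≡∂S ⟨
    e S + (e (∁ S) + ∂ (∁ S))        ≡⟨ cong (e S +_) (e+∂ (∁ S)) ⟩
    e S + Δ * ∣ ∁ S ∣                ∎
    where open ≡-Reasoning

  ∁S-odd : Even n → Odd ∣ ∁ S ∣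
  ∁S-odd n-even = odd∧even-sum⇒odd (proj₁ S-odd) (subst Even (sym ∣S∣+∣∁S∣≡n) n-even)
    where
    ∣S∣+∣∁S∣≡n : ∣ S ∣ + ∣ ∁ S ∣ ≡ n
    ∣S∣+∣∁S∣≡n = trans (cong (∣ S ∣ +_) (∣∁p∣≡n∸∣p∣ S)) (m+[n∸m]≡n (∣p∣≤n S))

  module _ (A : Subset n) (A-odd : Odd ∣ A ∣) (A-excess : e A + Δ * ∣ S ∣ ≡ e S + Δ * ∣ A ∣) where

    open Shrinking G A

    shrink-maxDeg : ∂ A ≤ Δ → MaxDegLe (shrink G A) Δ
    shrink-maxDeg ∂A≤Δ zero    = subst (_≤ Δ) (sym deg-new) ∂A≤Δ
    shrink-maxDeg ∂A≤Δ (suc i) = subst (_≤ Δ) (sym (deg-old i)) (≤-reflexive (regular _))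

    A-full : Δ * ∣ A ∣ ≤ Δ + e A
    A-full = +-cancelˡ-≤ (e S) _ _ (begin
      e S + Δ * ∣ A ∣     ≡⟨ A-excess ⟨
      e A + Δ * ∣ S ∣     ≤⟨ +-monoʳ-≤ (e A) S-full-ℕ ⟩
      e A + (Δ + e S)     ≡⟨ +-comm (e A) _ ⟩
      Δ + e S + e A       ≡⟨ cong (_+ e A) (+-comm Δ (e S)) ⟩
      e S + Δ + e A       ≡⟨ +-assoc (e S) Δ (e A) ⟩
      e S + (Δ + e A)     ∎)
      where open ≤-Reasoning

    -- If T ∋ s had e(T) > Δ(|T| − 1), its expansion would be a Δ-overfull set of G
    -- whose excess exceeds that of A, which is maximum.
    expand-arcs≤ : ∀ bs → OddSub (true ∷ bs) → 2 * eInd (shrink G A) (true ∷ bs) ≤ Δ * ∣ bs ∣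
    expand-arcs≤ bs (T-odd , 3≤∣T∣) with Δ * ∣ bs ∣ ≤? 2 * eInd (shrink G A) (true ∷ bs)
    ... | no  Δk≰e′ = <⇒≤ (≰⇒> Δk≰e′)
    ... | yes Δk≤e′ = +-cancelˡ-≤ (e A + Δ * ∣ S ∣) _ _ (begin
      e A + Δ * ∣ S ∣ + e′           ≡⟨ +-comm (e A + Δ * ∣ S ∣) e′ ⟩
      e′ + (e A + Δ * ∣ S ∣)         ≡⟨ +-assoc e′ (e A) _ ⟨
      e′ + e A + Δ * ∣ S ∣           ≡⟨ cong (_+ Δ * ∣ S ∣) eX≡ ⟨
      e X + Δ * ∣ S ∣                ≤⟨ S-max-ℕ X X-odd X-full ⟩
      e S + Δ * ∣ X ∣                ≡⟨ cong (λ x → e S + Δ * x) ∣X∣≡ ⟩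
      e S + Δ * (∣ A ∣ + k)          ≡⟨ cong (e S +_) (*-distribˡ-+ Δ ∣ A ∣ k) ⟩
      e S + (Δ * ∣ A ∣ + Δ * k)      ≡⟨ +-assoc (e S) _ _ ⟨
      e S + Δ * ∣ A ∣ + Δ * k        ≡⟨ cong (_+ Δ * k) A-excess ⟨
      e A + Δ * ∣ S ∣ + Δ * k        ∎)
      where
      open ≤-Reasoning
      k : ℕ
      k = ∣ bs ∣
      e′ : ℕ
      e′ = 2 * eInd (shrink G A) (true ∷ bs)
      X : Subset n
      X = expand (true ∷ bs)

      ∣X∣≡ : ∣ X ∣ ≡ ∣ A ∣ + k
      ∣X∣≡ = trans (∣expand∣ true bs) (cong (_+ k) (*-identityˡ ∣ A ∣))

      eX≡ : e X ≡ e′ + e A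
      eX≡ = trans (sym (eInd-expand isG true bs)) (cong (e′ +_) (*-identityˡ (e A)))

      X-odd : OddSub X
      X-odd = subst Odd (sym ∣X∣≡) (odd+even⇒odd A-odd (odd-suc⇒even T-odd))
            , subst (3 ≤_) (sym ∣X∣≡) (+-mono-≤ (odd⇒1≤ A-odd) (s≤s⁻¹ 3≤∣T∣))

      X-full : Δ * ∣ X ∣ ≤ Δ + e X
      X-full = begin
        Δ * ∣ X ∣              ≡⟨ cong (Δ *_) ∣X∣≡ ⟩
        Δ * (∣ A ∣ + k)        ≡⟨ *-distribˡ-+ Δ ∣ A ∣ k ⟩
        Δ * ∣ A ∣ + Δ * k      ≤⟨ +-mono-≤ A-full Δk≤e′ ⟩
        Δ + e A + e′           ≡⟨ +-assoc Δ (e A) e′ ⟩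
        Δ + (e A + e′)         ≡⟨ cong (Δ +_) (trans (+-comm (e A) e′) (sym eX≡)) ⟩
        Δ + e X                ∎

    t-shrink≤ : ∀ γ → (∀ T → OddSub T → t G T Q.≤ γ) → ∀ T → OddSub T → t (shrink G A) T Q.≤ γ
    t-shrink≤ γ t≤γ (false ∷ bs) (T-odd , 3≤∣T∣) =
      subst (Q._≤ γ) (sym t≡) (t≤γ X (subst Odd ∣T∣≡∣X∣ T-odd , subst (3 ≤_) ∣T∣≡∣X∣ 3≤∣T∣))
      where
      X : Subset n
      X = expand (false ∷ bs)
      ∣T∣≡∣X∣ : ∣ bs ∣ ≡ ∣ X ∣
      ∣T∣≡∣X∣ = sym (∣expand∣ false bs)
      t≡ : t (shrink G A) (false ∷ bs) ≡ t G X
      t≡ = cong₂ (λ num size → mkℚᵘ (ℤ.+ num) (size ∸ 2))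
             (trans (sym (+-identityʳ _)) (eInd-expand isG false bs)) ∣T∣≡∣X∣
    t-shrink≤ γ t≤γ (true ∷ bs) T-odd = ℚᵘP.≤-trans t≤Δ (ℚᵘP.≤-trans S-full (t≤γ S S-odd))
      where
      t≤Δ : t (shrink G A) (true ∷ bs) Q.≤ ℕ→ℚᵘ Δ
      t≤Δ = mkℚᵘ≤ℕ→ℚᵘ (suc ∣ bs ∣) (oddSub⇒2≤ (true ∷ bs) T-odd)
              (subst (Δ + 2 * eInd (shrink G A) (true ∷ bs) ≤_) (sym (*-suc Δ ∣ bs ∣))
                (+-monoʳ-≤ Δ (expand-arcs≤ bs T-odd)))

    shrink-Γ≤ : (γS γ : ℚᵘ) → IsΓ (shrink G A) γS → IsΓ G γ → γS Q.≤ γ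
    shrink-Γ≤ γS γ ((T , T-odd , γS≃tT) , _) (_ , t≤γ) =
      ℚᵘP.≤-trans (ℚᵘP.≤-reflexive γS≃tT) (t-shrink≤ γ t≤γ T T-odd)

lemmaG : (n : ℕ) (G : Mult n) (Δ : ℕ) → IsMultigraph G → Regular G Δ → Even n →
    (S : Subset n) → OddSub S → FullOrOverfull G S Δ →
    (∀ (T : Subset n) → OddSub T → FullOrOverfull G T Δ → ex G T Δ Q.≤ ex G S Δ) →
    MaxDegLe (shrink G S) Δ × MaxDegLe (shrink G (∁ S)) Δ ×
    (3 ≤ shrinkSize S → (γS γ : ℚᵘ) → IsΓ (shrink G S) γS → IsΓ G γ → γS Q.≤ γ) ×
    (3 ≤ shrinkSize (∁ S) → (γS γ : ℚᵘ) → IsΓ (shrink G (∁ S)) γS → IsΓ G γ → γS Q.≤ γ)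
lemmaG n G Δ isG regular n-even S S-odd S-full S-max =
    shrink-maxDeg S (proj₁ S-odd) refl ∂S≤Δ
  , shrink-maxDeg (∁ S) (∁S-odd n-even) ∁S-excess (subst (_≤ Δ) (sym ∂∁S≡∂S) ∂S≤Δ)
  , (λ _ → shrink-Γ≤ S (proj₁ S-odd) refl)
  , (λ _ → shrink-Γ≤ (∁ S) (∁S-odd n-even) ∁S-excess)
  where open MaximumExcess G Δ isG regular S S-odd S-full S-max
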